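{- Let $\mathcal{S}=\{T_1,\dots,T_k\}$ be phylogenetic trees with $\Lambda(T_1)=\dots=\Lambda(T_k)=L$. Run the following procedure ("Phase 1"): set $T:=T_1$ and $\mathit{count}(v):=1$ for every $v\in V(T)$. For $j=2,\dots,k$: (a) for each $v\in V(T)$, if $\Lambda(T[v])$ occurs in $T_j$ then increase $\mathit{count}(v)$ by $1$, else if $\Lambda(T[v])$ is not compatible with $T_j$ then decrease $\mathit{count}(v)$ by $1$ (otherwise leave it unchanged); (b) for each $v\in V(T)$ in top-down order, if $\mathit{count}(v)=0$ then perform a delete operation on $v$; (c) for every $C\in\mathcal{C}(T_j)$ that is compatible with $T$ but does not occur in $T$, insert $C$ into $T$ and set $\mathit{count}(v):=1$ for the new node $v$ with $\Lambda(T[v])=C$. Then for every $C\subseteq L$, if $C$ is a majority (+) cluster of $\mathcal{S}$, then $C\in\mathcal{C}(T)$ at the end of this procedure.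
   Context: A phylogenetic tree is a rooted, unordered, leaf-labeled tree in which every internal node has at least two children and all leaves have distinct labels; $\Lambda(T)$ denotes its set of leaf labels and $T[u]$ the subtree rooted at node $u$. A cluster of $L$ is a nonempty subset of $L$. The cluster collection of $T$ is $\mathcal{C}(T)=\{\Lambda(T[u]) : u\in V(T)\}$; $C$ occurs in $T$ if $C\in\mathcal{C}(T)$. Clusters $C_1,C_2$ are compatible if $C_1\subseteq C_2$, $C_2\subseteq C_1$ or $C_1\cap C_2=\emptyset$; $C$ is compatible with $T$ if it is compatible with $\Lambda(T[u])$ for all $u\in V(T)$. The delete operation on a non-root internal node $u$ makes all children of $u$ children of $u$'s parent and removes $u$, changing $\mathcal{C}(T)$ to $\mathcal{C}(T)\setminus\{\Lambda(T[u])\}$. Inserting a cluster $C$ compatible with $T$ (not already occurring) means modifying $T$ so that its cluster collection becomes $\mathcal{C}(T)\cup\{C\}$ (create a new node $u$ as child of an internal node $v$ and parent of a proper subset of at least two of $v$'s children whose leaf sets union to $C$). $K_C(\mathcal{S})$ is the set of trees of $\mathcal{S}$ in which $C$ occurs, $Q_C(\mathcal{S})$ the set of trees of $\mathcal{S}$ with which $C$ is not compatible; $C$ is a majority (+) cluster of $\mathcal{S}$ if $|K_C(\mathcal{S})|>|Q_C(\mathcal{S})|$. -}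

module Defs where

open import Data.Nat using (ℕ; zero; suc; _∸_; _<_)
open import Data.Bool using (Bool; true; false; if_then_else_)
import Data.Bool as Bool
open import Data.Fin using (Fin)
open import Data.Fin.Subset using (Subset; _⊆_; _∩_; _∪_; ⊥; ⁅_⁆)
open import Data.Fin.Subset.Properties using (_⊆?_)
open import Data.Vec.Properties using (≡-dec)
open import Data.List using (List; []; _∷_; _++_; map; filter; foldl; length)
open import Data.List.Relation.Unary.All using (All)
open import Data.List.Relation.Unary.Unique.Propositional using (Unique)
open import Data.List.Membership.Propositional using (_∈_)
open import Data.List.Membership.DecPropositional using (_∈?_)
open import Data.List.Relation.Unary.All as All using (all?)
open import Data.Product using (_×_; _,_; proj₁; proj₂)
open import Data.Sum using (_⊎_)
open import Relation.Nullary using (¬_; Dec; yes; no; ¬?)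
open import Relation.Nullary.Decidable using (_⊎-dec_; ⌊_⌋)
open import Relation.Binary.PropositionalEquality using (_≡_; _≢_)
open import Relation.Binary.Definitions using (DecidableEquality)

-- Leaf-label set L is Fin n; clusters are subsets of Fin n.

-- Rooted, unordered (the order of the children list is irrelevant to
-- everything below), leaf-labelled trees.
data Tree (n : ℕ) : Set where
  leaf : Fin n → Tree n
  node : List (Tree n) → Tree n

mutual
  leaves : ∀ {n} → Tree n → List (Fin n)
  leaves (leaf i)  = i ∷ []
  leaves (node ts) = leavesF ts

  leavesF : ∀ {n} → List (Tree n) → List (Fin n)
  leavesF []       = []
  leavesF (t ∷ ts) = leaves t ++ leavesF ts

mutual
  Λ : ∀ {n} → Tree n → Subset n
  Λ (leaf i)  = ⁅ i ⁆
  Λ (node ts) = ΛF ts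

  ΛF : ∀ {n} → List (Tree n) → Subset n
  ΛF []       = ⊥
  ΛF (t ∷ ts) = Λ t ∪ ΛF ts

mutual
  clusters : ∀ {n} → Tree n → List (Subset n)
  clusters (leaf i)    = ⁅ i ⁆ ∷ []
  clusters t@(node ts) = Λ t ∷ clustersF ts

  clustersF : ∀ {n} → List (Tree n) → List (Subset n)
  clustersF []       = []
  clustersF (t ∷ ts) = clusters t ++ clustersF ts

mutual
  Branching : ∀ {n} → Tree n → Set
  Branching (leaf i)  = Data.Unit.⊤ where import Data.Unit
  Branching (node ts) = (2 Data.Nat.≤ length ts) × BranchingF ts

  BranchingF : ∀ {n} → List (Tree n) → Set
  BranchingF []       = Data.Unit.⊤ where import Data.Unit
  BranchingF (t ∷ ts) = Branching t × BranchingF ts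

IsPhyloOn : ∀ {n} → Tree n → Set
IsPhyloOn {n} T = Branching T × Unique (leaves T) × (∀ (i : Fin n) → i ∈ leaves T)

_≟S_ : ∀ {n} → DecidableEquality (Subset n)
_≟S_ = ≡-dec Bool._≟_

Compatible : ∀ {n} → Subset n → Subset n → Set
Compatible C₁ C₂ = C₁ ⊆ C₂ ⊎ C₂ ⊆ C₁ ⊎ (C₁ ∩ C₂) ≡ ⊥

compatible? : ∀ {n} (C₁ C₂ : Subset n) → Dec (Compatible C₁ C₂)
compatible? C₁ C₂ = (C₁ ⊆? C₂) ⊎-dec ((C₂ ⊆? C₁) ⊎-dec ((C₁ ∩ C₂) ≟S ⊥))

CompatibleWithColl : ∀ {n} → Subset n → List (Subset n) → Set
CompatibleWithColl C Cs = All (Compatible C) Cs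

compatibleWithColl? : ∀ {n} (C : Subset n) (Cs : List (Subset n)) → Dec (CompatibleWithColl C Cs)
compatibleWithColl? C Cs = all? (compatible? C) Cs

Occurs : ∀ {n} → Subset n → Tree n → Set
Occurs C T = C ∈ clusters T

occurs? : ∀ {n} (C : Subset n) (T : Tree n) → Dec (Occurs C T)
occurs? C T = _∈?_ _≟S_ C (clusters T)

CompatibleWithTree : ∀ {n} → Subset n → Tree n → Set
CompatibleWithTree C T = CompatibleWithColl C (clusters T)

compatibleWithTree? : ∀ {n} (C : Subset n) (T : Tree n) → Dec (CompatibleWithTree C T)
compatibleWithTree? C T = compatibleWithColl? C (clusters T)

Kcount : ∀ {n} → Subset n → List (Tree n) → ℕ
Kcount C S = length (filter (occurs? C) S)

Qcount : ∀ {n} → Subset n → List (Tree n) → ℕ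
Qcount C S = length (filter (λ T → ¬? (compatibleWithTree? C T)) S)

MajorityCluster : ∀ {n} → Subset n → List (Tree n) → Set
MajorityCluster C S = Qcount C S < Kcount C S

-- Phase 1.  The working tree T is represented by its nodes, each node v
-- recorded as the pair (Λ(T[v]) , count(v)).  Distinct nodes of a
-- phylogenetic tree have distinct clusters, and delete/insert are
-- specified by their effect on C(T), so this carries all information the
-- procedure uses.

State : ℕ → Set
State n = List (Subset n × ℕ)

coll : ∀ {n} → State n → List (Subset n)
coll = map proj₁

initState : ∀ {n} → Tree n → State n
initState T = map (λ C → C , 1) (clusters T)

updateCount : ∀ {n} → Tree n → Subset n × ℕ → Subset n × ℕ
updateCount Tj (C , c) with occurs? C Tj
... | yes _ = C , suc c
... | no  _ with compatibleWithTree? C Tj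
...   | yes _ = C , c
...   | no  _ = C , c ∸ 1

stepA : ∀ {n} → Tree n → State n → State n
stepA Tj = map (updateCount Tj)

-- step (b): delete every node whose count is 0 (deleting a node does not
-- change the cluster or count of any other node, so the top-down order
-- does not affect the result)
stepB : ∀ {n} → State n → State n
stepB = filter (λ v → ¬? (proj₂ v Data.Nat.≟ 0))

stepC : ∀ {n} → Tree n → State n → State n
stepC Tj st =
  st ++ map (λ C → C , 1)
            (filter (λ C → compatibleWithColl? C (coll st)
                             Relation.Nullary.Decidable.×-dec
                           ¬? (_∈?_ _≟S_ C (coll st)))
                    (clusters Tj))

step : ∀ {n} → State n → Tree n → State n
step st Tj = stepC Tj (stepB (stepA Tj st))

phase1 : ∀ {n} → Tree n → List (Tree n) → State n
phase1 T₁ rest = foldl step (initState T₁) rest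

phase1Clusters : ∀ {n} → Tree n → List (Tree n) → List (Subset n)
phase1Clusters T₁ rest = coll (phase1 T₁ rest)

{-# OPTIONS --safe #-}

-- Fix C and let K and Q be the numbers of trees processed so far in which C
-- occurs, resp. with which C is incompatible.  Phase 1 behaves like a
-- Boyer–Moore majority vote: a node for C has count at least K − Q, a node
-- for a rival (a cluster incompatible with C) has count at most 1 + Q − K,
-- and C is absent only if K ≤ Q.  Since the clusters of a phylogenetic tree
-- are pairwise compatible, a tree containing C raises the count of C and
-- lowers that of every rival; if C still cannot be inserted, a surviving
-- rival with positive count witnesses K < Q.  At the end Q < K, so C is
-- present.

module Submission where

open import Defs
open import Data.Nat using (ℕ; zero; suc; _+_; _∸_; _≤_; _<_; z≤n; s≤s; _≟_)
open import Data.Nat.Properties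
  using ( ≤-refl; ≤-reflexive; ≤-trans; ≤-pred; <-≤-trans; <⇒≱; n≤1+n; m≤n+m; m<m+n
        ; n≢0⇒n>0; m∸n≤m; m∸n≡0⇒m≤n; +-suc; +-comm; +-identityʳ; +-monoˡ-≤; +-monoʳ-≤
        ; module ≤-Reasoning )
open import Data.List using (List; []; _∷_; _++_; map; foldl)
open import Data.List.Properties using (filter-all)
open import Data.List.Relation.Unary.All as All using (All; []; _∷_)
open import Data.List.Relation.Unary.All.Properties using (¬All⇒Any¬; ++⁻ˡ; ++⁻ʳ)
open import Data.List.Relation.Unary.AllPairs using ([]; _∷_)
open import Data.List.Relation.Unary.Any using (here; there)
open import Data.List.Relation.Unary.Unique.Propositional using (Unique)
open import Data.List.Relation.Binary.Disjoint.Propositional using (Disjoint)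
open import Data.List.Membership.Propositional using (_∈_; _∉_; find)
open import Data.List.Membership.Propositional.Properties
  using (∈-++⁺ˡ; ∈-++⁺ʳ; ∈-++⁻; ∈-map⁺; ∈-map⁻; ∈-filter⁺; ∈-filter⁻)
open import Data.List.Membership.DecPropositional using (_∈?_)
open import Data.Fin.Subset as Subset using (Subset; _⊆_; _∩_)
open import Data.Fin.Subset.Properties
  using (Empty-unique; ∉⊥; x∈⁅y⁆⇒x≡y; ⊆-refl; p⊆p∪q; q⊆p∪q; x∈p∪q⁻; x∈p∩q⁻; ∩-comm)
open import Data.Product using (_×_; _,_; proj₁; proj₂; ∃)
open import Data.Sum using (_⊎_; inj₁; inj₂)
open import Data.Empty using (⊥-elim)
open import Function using (_∘_)
open import Relation.Nullary using (¬_; yes; no; contradiction)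
open import Relation.Nullary.Decidable using (_×-dec_; ¬?)
open import Relation.Unary using (Decidable)
open import Relation.Binary.PropositionalEquality
  using (_≡_; _≢_; refl; sym; trans; cong; subst)

private
  variable
    n : ℕ
    t : Tree n
    st : State n
    X Y D : Subset n
    c c′ : ℕ

Compatible-refl : Compatible X X
Compatible-refl = inj₁ ⊆-refl

Compatible-sym : Compatible X Y → Compatible Y X
Compatible-sym (inj₁ X⊆Y)        = inj₂ (inj₁ X⊆Y)
Compatible-sym (inj₂ (inj₁ Y⊆X)) = inj₁ Y⊆X
Compatible-sym {X = X} {Y} (inj₂ (inj₂ X∩Y≡⊥)) = inj₂ (inj₂ (trans (∩-comm Y X) X∩Y≡⊥))

Unique-++⁻ : ∀ {A : Set} (xs : List A) {ys} → Unique (xs ++ ys) →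
             Unique xs × Unique ys × Disjoint xs ys
Unique-++⁻ []       u        = [] , u , λ ()
Unique-++⁻ (x ∷ xs) (x∉ ∷ u) with Unique-++⁻ xs u
... | uxs , uys , xs#ys = ++⁻ˡ xs x∉ ∷ uxs , uys , x∷xs#ys
  where
  x∷xs#ys : Disjoint (x ∷ xs) _
  x∷xs#ys (here refl , x∈ys) = All.lookup (++⁻ʳ xs x∉) x∈ys refl
  x∷xs#ys (there v∈xs , v∈ys) = xs#ys (v∈xs , v∈ys)

mutual
  Λ⊆leaves : ∀ (t : Tree n) {i} → i Subset.∈ Λ t → i ∈ leaves t
  Λ⊆leaves (leaf j)  i∈ = here (x∈⁅y⁆⇒x≡y j i∈)
  Λ⊆leaves (node ts) i∈ = ΛF⊆leavesF ts i∈

  ΛF⊆leavesF : ∀ (ts : List (Tree n)) {i} → i Subset.∈ ΛF ts → i ∈ leavesF ts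
  ΛF⊆leavesF []       i∈ = ⊥-elim (∉⊥ i∈)
  ΛF⊆leavesF (t ∷ ts) i∈ with x∈p∪q⁻ (Λ t) (ΛF ts) i∈
  ... | inj₁ i∈t  = ∈-++⁺ˡ (Λ⊆leaves t i∈t)
  ... | inj₂ i∈ts = ∈-++⁺ʳ (leaves t) (ΛF⊆leavesF ts i∈ts)

mutual
  clusters⊆Λ : ∀ (t : Tree n) → X ∈ clusters t → X ⊆ Λ t
  clusters⊆Λ (leaf i)  (here refl) = ⊆-refl
  clusters⊆Λ (node ts) (here refl) = ⊆-refl
  clusters⊆Λ (node ts) (there X∈) = clustersF⊆ΛF ts X∈

  clustersF⊆ΛF : ∀ (ts : List (Tree n)) → X ∈ clustersF ts → X ⊆ ΛF ts
  clustersF⊆ΛF (t ∷ ts) X∈ with ∈-++⁻ (clusters t) X∈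
  ... | inj₁ X∈t  = λ i∈ → p⊆p∪q (ΛF ts) (clusters⊆Λ t X∈t i∈)
  ... | inj₂ X∈ts = λ i∈ → q⊆p∪q (Λ t) (ΛF ts) (clustersF⊆ΛF ts X∈ts i∈)

siblings-disjoint : ∀ (t : Tree n) ts → Disjoint (leaves t) (leavesF ts) →
                    X ∈ clusters t → Y ∈ clustersF ts → X ∩ Y ≡ Subset.⊥
siblings-disjoint {X = X} {Y} t ts t#ts X∈ Y∈ = Empty-unique λ (i , i∈X∩Y) →
  let i∈X , i∈Y = x∈p∩q⁻ X Y i∈X∩Y
  in t#ts (Λ⊆leaves t (clusters⊆Λ t X∈ i∈X) , ΛF⊆leavesF ts (clustersF⊆ΛF ts Y∈ i∈Y))

mutual
  clusters-compatible : ∀ (t : Tree n) → Unique (leaves t) →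
                        X ∈ clusters t → Y ∈ clusters t → Compatible X Y
  clusters-compatible (leaf i)  _ (here refl) (here refl) = Compatible-refl
  clusters-compatible (node ts) _ (here refl) (here refl) = Compatible-refl
  clusters-compatible (node ts) _ (here refl) (there Y∈)  = inj₂ (inj₁ (clustersF⊆ΛF ts Y∈))
  clusters-compatible (node ts) _ (there X∈)  (here refl) = inj₁ (clustersF⊆ΛF ts X∈)
  clusters-compatible (node ts) u (there X∈)  (there Y∈)  = clustersF-compatible ts u X∈ Y∈

  clustersF-compatible : ∀ (ts : List (Tree n)) → Unique (leavesF ts) →
                         X ∈ clustersF ts → Y ∈ clustersF ts → Compatible X Y
  clustersF-compatible (t ∷ ts) u X∈ Y∈
    with Unique-++⁻ (leaves t) u | ∈-++⁻ (clusters t) X∈ | ∈-++⁻ (clusters t) Y∈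
  ... | ut , _ , _    | inj₁ X∈t  | inj₁ Y∈t  = clusters-compatible t ut X∈t Y∈t
  ... | _ , uts , _   | inj₂ X∈ts | inj₂ Y∈ts = clustersF-compatible ts uts X∈ts Y∈ts
  ... | _ , _ , t#ts  | inj₁ X∈t  | inj₂ Y∈ts =
    inj₂ (inj₂ (siblings-disjoint t ts t#ts X∈t Y∈ts))
  ... | _ , _ , t#ts  | inj₂ X∈ts | inj₁ Y∈t  =
    Compatible-sym (inj₂ (inj₂ (siblings-disjoint t ts t#ts Y∈t X∈ts)))

occurs⇒compatibleWithTree : IsPhyloOn t → Occurs X t → CompatibleWithTree X t
occurs⇒compatibleWithTree {t = t} (_ , u , _) X∈ = All.tabulate (clusters-compatible t u X∈)

∈-coll⁺ : (D , c) ∈ st → D ∈ coll st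
∈-coll⁺ = ∈-map⁺ proj₁

∈-coll⁻ : D ∈ coll st → ∃ λ c → (D , c) ∈ st
∈-coll⁻ D∈ with ∈-map⁻ proj₁ D∈
... | (_ , c) , e∈ , refl = c , e∈

data CountChange (t : Tree n) (D : Subset n) (c : ℕ) : ℕ → Set where
  occurs       : Occurs D t → CountChange t D c (suc c)
  compatible   : ¬ Occurs D t → CompatibleWithTree D t → CountChange t D c c
  incompatible : ¬ Occurs D t → ¬ CompatibleWithTree D t → CountChange t D c (c ∸ 1)

updateCount-change : ∀ (t : Tree n) D c →
                     ∃ λ c′ → updateCount t (D , c) ≡ (D , c′) × CountChange t D c c′
updateCount-change t D c with occurs? D t
... | yes oD = suc c , refl , occurs oD
... | no ¬oD with compatibleWithTree? D t
...   | yes cwD = c , refl , compatible ¬oD cwD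
...   | no ¬cwD = c ∸ 1 , refl , incompatible ¬oD ¬cwD

CountChange-≤suc : CountChange t D c c′ → c′ ≤ suc c
CountChange-≤suc             (occurs _)         = ≤-refl
CountChange-≤suc {c = c} (compatible _ _)   = n≤1+n c
CountChange-≤suc {c = c} (incompatible _ _) = ≤-trans (m∸n≤m c 1) (n≤1+n c)

deleted-count≤1 : CountChange t D c c′ → c′ ≡ 0 → c ≤ 1
deleted-count≤1 (compatible _ _)   refl   = z≤n
deleted-count≤1 (incompatible _ _) c∸1≡0 = m∸n≡0⇒m≤n c∸1≡0

deleted-compatible-count≡0 : CompatibleWithTree D t → CountChange t D c c′ → c′ ≡ 0 → c ≡ 0
deleted-compatible-count≡0 _   (compatible _ _)     c≡0 = c≡0
deleted-compatible-count≡0 cwD (incompatible _ ¬cwD) _  = contradiction cwD ¬cwD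

Insertable : State n → Subset n → Set
Insertable st D = CompatibleWithColl D (coll st) × D ∉ coll st

insertable? : ∀ (st : State n) → Decidable (Insertable st)
insertable? st D = compatibleWithColl? D (coll st) ×-dec ¬? (_∈?_ _≟S_ D (coll st))

module OneStep (t : Tree n) (st : State n) where

  survivors : State n
  survivors = stepB (stepA t st)

  survivors⁻ : (D , c′) ∈ survivors → ∃ λ c → (D , c) ∈ st × CountChange t D c c′ × c′ ≢ 0
  survivors⁻ m with ∈-filter⁻ (λ v → ¬? (proj₂ v ≟ 0)) {xs = stepA t st} m
  ... | m₁ , c′≢0 with ∈-map⁻ (updateCount t) m₁
  ... | (D₀ , c) , m₀ , eq with updateCount-change t D₀ c
  ... | c″ , eq′ , change with trans eq eq′
  ... | refl = c , m₀ , change , c′≢0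

  survives-or-deleted : (D , c) ∈ st →
                        ∃ λ c′ → CountChange t D c c′ × (D ∈ coll survivors ⊎ c′ ≡ 0)
  survives-or-deleted {D = D} {c = c} m with updateCount-change t D c
  ... | c′ , eq , change with c′ ≟ 0
  ...   | yes c′≡0 = c′ , change , inj₂ c′≡0
  ...   | no  c′≢0 = c′ , change , inj₁ (∈-coll⁺ (∈-filter⁺ (λ v → ¬? (proj₂ v ≟ 0))
                       (subst (_∈ stepA t st) eq (∈-map⁺ (updateCount t) m)) c′≢0))

  step⁻ : (D , c) ∈ step st t →
          (D , c) ∈ survivors ⊎ (c ≡ 1 × D ∈ clusters t × Insertable survivors D)
  step⁻ m with ∈-++⁻ survivors m
  ... | inj₁ m-old = inj₁ m-old
  ... | inj₂ m-new with ∈-map⁻ (λ C → C , 1) m-new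
  ...   | D , D∈ , refl with ∈-filter⁻ (insertable? survivors) {xs = clusters t} D∈
  ...     | D∈t , ins = inj₂ (refl , D∈t , ins)

  coll-survivors⊆coll-step : D ∈ coll survivors → D ∈ coll (step st t)
  coll-survivors⊆coll-step D∈ = let _ , m = ∈-coll⁻ D∈ in ∈-coll⁺ (∈-++⁺ˡ m)

  inserted-or-blocked : D ∈ clusters t →
                        D ∈ coll (step st t) ⊎ ∃ λ E → E ∈ coll survivors × ¬ Compatible D E
  inserted-or-blocked {D = D} D∈t with _∈?_ _≟S_ D (coll survivors)
  ... | yes D∈ = inj₁ (coll-survivors⊆coll-step D∈)
  ... | no  D∉ with compatibleWithColl? D (coll survivors)
  ...   | yes D~survivors = inj₁ (∈-coll⁺ (∈-++⁺ʳ survivors (∈-map⁺ (λ C → C , 1)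
                              (∈-filter⁺ (insertable? survivors) D∈t (D~survivors , D∉)))))
  ...   | no  D≁survivors = inj₂ (find (¬All⇒Any¬ (compatible? D) (coll survivors) D≁survivors))

step-[]≡initState : ∀ (t : Tree n) → step [] t ≡ initState t
step-[]≡initState t =
  cong (map (λ C → C , 1)) (filter-all (insertable? []) (All.tabulate λ _ → [] , λ ()))

module MajorityInvariant (C : Subset n) where

  record Invariant (K Q : ℕ) (st : State n) : Set where
    field
      C-count     : ∀ {c} → (C , c) ∈ st → K ≤ c + Q
      rival-count : ∀ {D c} → (D , c) ∈ st → ¬ Compatible C D → K + c ≤ suc Q
      C-present   : C ∈ coll st ⊎ K ≤ Q

  Invariant-[] : Invariant 0 0 []
  Invariant-[] = record { C-count = λ () ; rival-count = λ () ; C-present = inj₂ z≤n }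

  Invariant⇒present : ∀ {K Q st} → Invariant K Q st → Q < K → C ∈ coll st
  Invariant⇒present inv Q<K with Invariant.C-present inv
  ... | inj₁ C∈  = C∈
  ... | inj₂ K≤Q = contradiction K≤Q (<⇒≱ Q<K)

  module Step {K Q} {st : State n} (t : Tree n) (inv : Invariant K Q st) where
    open Invariant inv
    open OneStep t st

    absent⇒K≤b+Q : ∀ {b} → C ∉ coll survivors →
                   (∀ {c c′} → CountChange t C c c′ → c′ ≡ 0 → c ≤ b) → K ≤ b + Q
    absent⇒K≤b+Q {b} C∉ deleted≤b with C-present
    ... | inj₂ K≤Q = ≤-trans K≤Q (m≤n+m Q b)
    ... | inj₁ C∈ with ∈-coll⁻ C∈
    ...   | c , m with survives-or-deleted m
    ...     | _ , _      , inj₁ C∈survivors = contradiction C∈survivors C∉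
    ...     | _ , change , inj₂ c′≡0 = ≤-trans (C-count m) (+-monoˡ-≤ Q (deleted≤b change c′≡0))

    absent⇒K≤Q : CompatibleWithTree C t → C ∉ coll survivors → K ≤ Q
    absent⇒K≤Q cwC C∉ = absent⇒K≤b+Q C∉ λ change c′≡0 →
      ≤-reflexive (deleted-compatible-count≡0 cwC change c′≡0)

    absent⇒K≤1+Q : C ∉ coll survivors → K ≤ suc Q
    absent⇒K≤1+Q C∉ = absent⇒K≤b+Q C∉ deleted-count≤1

    step-occurs : IsPhyloOn t → Occurs C t → Invariant (suc K) Q (step st t)
    step-occurs ph oC =
      record { C-count = C-count′ ; rival-count = rival-count′ ; C-present = C-present′ }
      where
      cwC : CompatibleWithTree C t
      cwC = occurs⇒compatibleWithTree ph oC

      C-count′ : ∀ {c} → (C , c) ∈ step st t → suc K ≤ c + Q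
      C-count′ m with step⁻ m
      ... | inj₂ (refl , _ , _ , C∉) = s≤s (absent⇒K≤Q cwC C∉)
      ... | inj₁ m₂ with survivors⁻ m₂
      ...   | _ , m₁ , occurs _ , _           = s≤s (C-count m₁)
      ...   | _ , _  , compatible ¬oC _ , _   = contradiction oC ¬oC
      ...   | _ , _  , incompatible ¬oC _ , _ = contradiction oC ¬oC

      rival-count′ : ∀ {D c} → (D , c) ∈ step st t → ¬ Compatible C D → suc K + c ≤ suc Q
      rival-count′ m C≁D with step⁻ m
      ... | inj₂ (_ , D∈t , _) = contradiction (All.lookup cwC D∈t) C≁D
      ... | inj₁ m₂ with survivors⁻ m₂
      ...   | _ , _ , occurs oD , _           = contradiction (All.lookup cwC oD) C≁D
      ...   | _ , _ , compatible _ cwD , _    = contradiction (Compatible-sym (All.lookup cwD oC)) C≁D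
      ...   | zero  , _  , incompatible _ _ , c′≢0 = contradiction refl c′≢0
      ...   | suc c , m₁ , incompatible _ _ , _    = subst (_≤ suc Q) (+-suc K c) (rival-count m₁ C≁D)

      -- C is missing only if a surviving rival blocked its insertion.
      C-present′ : C ∈ coll (step st t) ⊎ suc K ≤ Q
      C-present′ with inserted-or-blocked oC
      ... | inj₁ C∈ = inj₁ C∈
      ... | inj₂ (D , D∈ , C≁D) with ∈-coll⁻ D∈
      ...   | c , m₂ with survivors⁻ m₂
      ...     | _ , _ , _ , c≢0 =
        inj₂ (<-≤-trans (m<m+n K (n≢0⇒n>0 c≢0)) (≤-pred (rival-count′ (∈-++⁺ˡ m₂) C≁D)))

    step-compatible : ¬ Occurs C t → CompatibleWithTree C t → Invariant K Q (step st t)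
    step-compatible ¬oC cwC =
      record { C-count = C-count′ ; rival-count = rival-count′ ; C-present = C-present′ }
      where
      C-count′ : ∀ {c} → (C , c) ∈ step st t → K ≤ c + Q
      C-count′ m with step⁻ m
      ... | inj₂ (_ , C∈t , _) = contradiction C∈t ¬oC
      ... | inj₁ m₂ with survivors⁻ m₂
      ...   | _ , _  , occurs oC , _            = contradiction oC ¬oC
      ...   | _ , m₁ , compatible _ _ , _       = C-count m₁
      ...   | _ , _  , incompatible _ ¬cwC , _  = contradiction cwC ¬cwC

      rival-count′ : ∀ {D c} → (D , c) ∈ step st t → ¬ Compatible C D → K + c ≤ suc Q
      rival-count′ m C≁D with step⁻ m
      ... | inj₂ (_ , D∈t , _) = contradiction (All.lookup cwC D∈t) C≁D
      ... | inj₁ m₂ with survivors⁻ m₂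
      ...   | _ , _  , occurs oD , _         = contradiction (All.lookup cwC oD) C≁D
      ...   | _ , m₁ , compatible _ _ , _    = rival-count m₁ C≁D
      ...   | c , m₁ , incompatible _ _ , _  = ≤-trans (+-monoʳ-≤ K (m∸n≤m c 1)) (rival-count m₁ C≁D)

      C-present′ : C ∈ coll (step st t) ⊎ K ≤ Q
      C-present′ with _∈?_ _≟S_ C (coll survivors)
      ... | yes C∈ = inj₁ (coll-survivors⊆coll-step C∈)
      ... | no  C∉ = inj₂ (absent⇒K≤Q cwC C∉)

    step-incompatible : IsPhyloOn t → ¬ CompatibleWithTree C t → Invariant K (suc Q) (step st t)
    step-incompatible ph ¬cwC =
      record { C-count = C-count′ ; rival-count = rival-count′ ; C-present = C-present′ }
      where
      ¬oC : ¬ Occurs C t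
      ¬oC = ¬cwC ∘ occurs⇒compatibleWithTree ph

      C-count′ : ∀ {c} → (C , c) ∈ step st t → K ≤ c + suc Q
      C-count′ m with step⁻ m
      ... | inj₂ (_ , C∈t , _) = contradiction C∈t ¬oC
      ... | inj₁ m₂ with survivors⁻ m₂
      ...   | _ , _ , occurs oC , _                    = contradiction oC ¬oC
      ...   | _ , _ , compatible _ cwC , _             = contradiction cwC ¬cwC
      ...   | zero  , _  , incompatible _ _ , c′≢0     = contradiction refl c′≢0
      ...   | suc c , m₁ , incompatible _ _ , _        = subst (K ≤_) (sym (+-suc c Q)) (C-count m₁)

      rival-count′ : ∀ {D c} → (D , c) ∈ step st t → ¬ Compatible C D → K + c ≤ suc (suc Q)
      rival-count′ {c = c′} m C≁D with step⁻ m
      ... | inj₁ m₂ with survivors⁻ m₂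
      ...   | c , m₁ , change , _ = begin
        K + c′       ≤⟨ +-monoʳ-≤ K (CountChange-≤suc change) ⟩
        K + suc c    ≡⟨ +-suc K c ⟩
        suc (K + c)  ≤⟨ s≤s (rival-count m₁ C≁D) ⟩
        suc (suc Q)  ∎
        where open ≤-Reasoning
      rival-count′ m C≁D | inj₂ (refl , _ , D~survivors , _) with _∈?_ _≟S_ C (coll survivors)
      ... | yes C∈ = contradiction (Compatible-sym (All.lookup D~survivors C∈)) C≁D
      ... | no  C∉ = subst (_≤ suc (suc Q)) (sym (+-comm K 1)) (s≤s (absent⇒K≤1+Q C∉))

      C-present′ : C ∈ coll (step st t) ⊎ K ≤ suc Q
      C-present′ with _∈?_ _≟S_ C (coll survivors)
      ... | yes C∈ = inj₁ (coll-survivors⊆coll-step C∈)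
      ... | no  C∉ = inj₂ (absent⇒K≤1+Q C∉)

  Invariant-foldl : ∀ ts {K Q st} → All IsPhyloOn ts → Invariant K Q st →
                    Invariant (K + Kcount C ts) (Q + Qcount C ts) (foldl step st ts)
  Invariant-foldl [] {K} {Q} _ inv rewrite +-identityʳ K | +-identityʳ Q = inv
  Invariant-foldl (t ∷ ts) {K} {Q} (ph ∷ phs) inv with occurs? C t | compatibleWithTree? C t
  ... | yes oC | no ¬cwC = contradiction (occurs⇒compatibleWithTree ph oC) ¬cwC
  ... | yes oC | yes _ rewrite +-suc K (Kcount C ts) =
    Invariant-foldl ts phs (Step.step-occurs t inv ph oC)
  ... | no ¬oC | yes cwC =
    Invariant-foldl ts phs (Step.step-compatible t inv ¬oC cwC)
  ... | no _   | no ¬cwC rewrite +-suc Q (Qcount C ts) =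
    Invariant-foldl ts phs (Step.step-incompatible t inv ph ¬cwC)

lemma4 : ∀ {n : ℕ} (T₁ : Tree n) (rest : List (Tree n)) →
           All IsPhyloOn (T₁ ∷ rest) →
           (C : Subset n) → MajorityCluster C (T₁ ∷ rest) →
           C ∈ phase1Clusters T₁ rest
lemma4 T₁ rest phylo C majority =
  subst (λ st → C ∈ coll st) (cong (λ st → foldl step st rest) (step-[]≡initState T₁))
        (Invariant⇒present (Invariant-foldl (T₁ ∷ rest) phylo Invariant-[]) majority)
  where open MajorityInvariant C
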